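{- Let $\epsilon\in(0,1)$ with $1/\epsilon$ an integer, and let $(\mathcal{N},W)$ be a well-spaced instance (with respect to $\epsilon$ and $n=|\mathcal{N}|$) with clusters $\mathcal{C}_1,\dots,\mathcal{C}_M$. Let $\pi^*$ be a permutation of $\mathcal{N}$ maximizing $\Psi$. Then there exist an item set $\mathcal{N}_{\mathrm{sparse}}\subseteq\mathcal{N}$ and a permutation $\pi_{\mathrm{sparse}}$ of $\mathcal{N}_{\mathrm{sparse}}$ such that (1) $\max_{m\in[M]}\mathrm{cross}_m(\pi_{\mathrm{sparse}})\le\frac{\lceil\log_2M\rceil}{\epsilon}$, and (2) $\Psi(\pi_{\mathrm{sparse}})\ge(1-\epsilon)\Psi(\pi^*)$.
   Context: An instance $(\mathcal{N},W)$ has item set $\mathcal{N}$ with strictly positive weights $w_i$, $T$ periods with capacities $W_1\le\cdots\le W_T$, and non-negative profits $p_{it}$. It is well-spaced (w.r.t. $\epsilon$ and $n$) with clusters $\mathcal{C}_1,\dots,\mathcal{C}_M$ if these partition $\mathcal{N}$ and: (1) weights of any two items in the same cluster differ by a factor of at most $n^{1/\epsilon}$; (2) for $m_1<m_2$, every item of $\mathcal{C}_{m_2}$ is heavier than every item of $\mathcal{C}_{m_1}$ by a factor of at least $n^{1+(m_2-m_1-1)/\epsilon}$. For a permutation $\pi$ of a set $S\subseteq\mathcal{N}$: $C_\pi(i)=\sum_{j\in S:\pi(j)\le\pi(i)}w_j$, $\varphi_\pi(i)=\max\{p_{it}:t\in[T+1],\ W_t\ge C_\pi(i)\}$ with $W_{T+1}=\infty$,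 $p_{i,T+1}=0$, and $\Psi(\pi)=\sum_{i\in S}\varphi_\pi(i)$. $\mathrm{cross}_m(\pi)$ is the number of items of $\mathcal{C}_{m+1}\cup\cdots\cup\mathcal{C}_M$ that appear in $\pi$ before the last item of $\mathcal{C}_m$ in $\pi$.
   Formalization: The item weights $w_i$, the capacities $W_t$ and the profits $p_{it}$ of an instance are taken to be rational numbers. -}

module Defs where

open import Data.Nat as ℕ using (ℕ; zero; suc)
open import Data.Fin as Fin using (Fin)
open import Data.Fin.Properties as FinP using ()
open import Data.List using (List; []; _∷_; reverse; map; foldr; allFin)
open import Data.Integer using (+_)
open import Data.Rational using (ℚ; 0ℚ; _+_; _⊔_; _≤_; _/_)
open import Data.Rational.Properties using (_≤?_)
open import Relation.Nullary using (yes; no)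

ℕ→ℚ : ℕ → ℚ
ℕ→ℚ k = + k / 1

-- An instance: n items (Fin n), T periods (Fin T).
record Instance (n T : ℕ) : Set where
  field
    w : Fin n → ℚ
    W : Fin T → ℚ
    p : Fin n → Fin T → ℚ

module _ {n T : ℕ} (I : Instance n T) where
  open Instance I

  -- φ(i) for cumulative weight c:
  -- max { p_{it} : t ∈ [T+1], W_t ≥ c }, with W_{T+1} = ∞ and p_{i,T+1} = 0.
  φ : Fin n → ℚ → ℚ
  φ i c = foldr (λ t acc → term t ⊔ acc) 0ℚ (allFin T)
    where
    term : Fin T → ℚ
    term t with c ≤? W t
    ... | yes _ = p i t
    ... | no  _ = 0ℚ

  -- Ψ of a permutation given as a list (in order π(·) = 1,2,…);
  -- c is the total weight of the items before the current one.
  ΨAcc : ℚ → List (Fin n) → ℚ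
  ΨAcc c []      = 0ℚ
  ΨAcc c (i ∷ l) = φ i (c + w i) + ΨAcc (c + w i) l

  Ψ : List (Fin n) → ℚ
  Ψ = ΨAcc 0ℚ

module _ {n M : ℕ} (cl : Fin n → Fin M) where

  countLater : Fin M → List (Fin n) → ℕ
  countLater m [] = 0
  countLater m (i ∷ l) with m Fin.<? cl i
  ... | yes _ = suc (countLater m l)
  ... | no  _ = countLater m l

  -- applied to the REVERSED permutation: find the first item of cluster m
  -- (= the last one in π) and count later-cluster items after it
  -- (= before it in π). If cluster m does not occur, the count is 0.
  crossRev : Fin M → List (Fin n) → ℕ
  crossRev m [] = 0
  crossRev m (i ∷ l) with cl i FinP.≟ m
  ... | yes _ = countLater m l
  ... | no  _ = crossRev m l

  cross : Fin M → List (Fin n) → ℕ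
  cross m π = crossRev m (reverse π)

  -- max_{m ∈ [M]} cross_m(π)  (0 if M = 0)
  maxCross : List (Fin n) → ℕ
  maxCross π = foldr ℕ._⊔_ 0 (map (λ m → cross m π) (allFin M))

module Submission where

-- Colour the items of π* greedily with k = 1/ε colours so that, for every threshold m, the
-- first k items of clusters above m receive pairwise distinct colours, hence all k colours.
-- By averaging, some colour class carries at most a (1/k)-share of the profit of π*; delete it.
-- A deleted item x leaves room w_x, which exceeds the total weight of all items of lower
-- clusters (consecutive clusters are n apart in weight), so the later survivors of the
-- clusters between the current threshold and that of x can be moved into that room, sorted by
-- cluster. No survivor then finishes later than in π*, so none loses profit, and an item of a
-- cluster above m can precede the last item of cluster m only if, in π*, it precedes the first
-- deleted item above m: fewer than k items. Thus cross_m < k ≤ ⌈log₂ M⌉ k when M ≥ 2, and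
-- cross_m = 0 when M ≤ 1.

open import Defs
open import Data.Fin as Fin using (Fin)
import Data.Fin.Properties as FinP
import Data.Integer as ℤ
import Data.Integer.Properties as ℤ
open import Data.List
  using (List; []; _∷_; _++_; length; filter; foldr; allFin; map; reverse; take)
open import Data.List.Membership.Propositional using (_∈_)
open import Data.List.Membership.Propositional.Properties
  using (∈-filter⁻; ∈-filter⁺; ∈-allFin; ∈-++⁺ʳ; ∈-map⁻; ∈-map⁺)
open import Data.List.Properties
  using ( filter-notAll; filter-none; filter-all; filter-accept; filter-reject; filter-++
        ; ∷-injective; unfold-reverse; reverse-++; reverse-involutive; ++-assoc; ++-identityʳ
        ; map-++; take-all; length-tabulate; length-++-sucʳ )
open import Data.List.Relation.Binary.Permutation.Propositional as ↭
  using (_↭_; ↭-refl; ↭-reflexive; ↭-sym; ↭-trans; prep; ↭⇒↭ₛ; module PermutationReasoning)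
open import Data.List.Relation.Binary.Permutation.Propositional.Properties
  using (shift; ++⁺ˡ; ++⁺ʳ; ∈-resp-↭)
open import Data.List.Relation.Unary.All using (All; []; _∷_)
import Data.List.Relation.Unary.All as All
import Data.List.Relation.Unary.All.Properties as All
open import Data.List.Relation.Unary.AllPairs using (AllPairs; []; _∷_)
import Data.List.Relation.Unary.AllPairs.Properties as AllPairs
open import Data.List.Relation.Unary.Any using (here; there)
import Data.List.Relation.Unary.Any as Any
open import Data.List.Relation.Unary.Unique.Propositional using (Unique)
import Data.List.Relation.Unary.Unique.Propositional.Properties as Unique
open import Data.Nat as ℕ using (ℕ; zero; suc)
import Data.Nat.Coprimality as Coprime
open import Data.Nat.Logarithm using (⌈log₂_⌉; ⌈log₂⌉-mono-≤)
import Data.Nat.Properties as ℕ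
open import Data.Product using (Σ; ∃; _×_; _,_; proj₁; proj₂)
open import Data.Rational
  using (ℚ; mkℚ; 0ℚ; 1ℚ; _+_; _*_; _-_; -_; _≤_; _<_; *≤*; toℚᵘ; Positive; nonNegative)
import Data.Rational.Properties as ℚ
import Data.Rational.Unnormalised as ℚᵘ
import Data.Rational.Unnormalised.Properties as ℚᵘ
open import Data.Sum using (_⊎_; inj₁; inj₂; [_,_])
open import Data.Unit using (tt)
open import Function using (_∘_; id; Surjective)
open import Relation.Binary.Bundles using (DecTotalOrder)
open import Relation.Binary.Definitions using (DecidableEquality)
open import Relation.Binary.PropositionalEquality hiding ([_])
open import Relation.Nullary using (¬_; yes; no; ¬?; contradiction)
open import Relation.Nullary.Decidable using (_×-dec_)
open import Relation.Unary using (Decidable; _≐_; _∪_; _∩_; Empty; U)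
open import Relation.Unary.Properties using (U?)
open import Data.List.Extrema (DecTotalOrder.totalOrder ℚ.≤-decTotalOrder)
  using (argmin; f[argmin]≤f[xs])

ℕ→ℚ≡mkℚ : ∀ m → ℕ→ℚ m ≡ mkℚ (ℤ.+ m) 0 (Coprime.sym (Coprime.1-coprimeTo m))
ℕ→ℚ≡mkℚ m = ℚ.normalize-coprime (Coprime.sym (Coprime.1-coprimeTo m))

toℚᵘ-ℕ→ℚ : ∀ m → toℚᵘ (ℕ→ℚ m) ≡ ℚᵘ.mkℚᵘ (ℤ.+ m) 0
toℚᵘ-ℕ→ℚ m = cong toℚᵘ (ℕ→ℚ≡mkℚ m)

ℕ→ℚ-+ : ∀ a b → ℕ→ℚ (a ℕ.+ b) ≡ ℕ→ℚ a + ℕ→ℚ b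
ℕ→ℚ-+ a b = ℚ.toℚᵘ-injective (begin-equality
  toℚᵘ (ℕ→ℚ (a ℕ.+ b))                      ≡⟨ toℚᵘ-ℕ→ℚ (a ℕ.+ b) ⟩
  ℚᵘ.mkℚᵘ (ℤ.+ (a ℕ.+ b)) 0                  ≃⟨ ℚᵘ.*≡* (cong (ℤ._* ℤ.+ 1) a*1+b*1≡a+b) ⟨
  ℚᵘ.mkℚᵘ (ℤ.+ a) 0 ℚᵘ.+ ℚᵘ.mkℚᵘ (ℤ.+ b) 0  ≡⟨ cong₂ ℚᵘ._+_ (toℚᵘ-ℕ→ℚ a) (toℚᵘ-ℕ→ℚ b) ⟨
  toℚᵘ (ℕ→ℚ a) ℚᵘ.+ toℚᵘ (ℕ→ℚ b)            ≃⟨ ℚ.toℚᵘ-homo-+ (ℕ→ℚ a) (ℕ→ℚ b) ⟨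
  toℚᵘ (ℕ→ℚ a + ℕ→ℚ b)                      ∎)
  where
  open ℚᵘ.≤-Reasoning
  a*1+b*1≡a+b : ℤ.+ a ℤ.* ℤ.+ 1 ℤ.+ ℤ.+ b ℤ.* ℤ.+ 1 ≡ ℤ.+ a ℤ.+ ℤ.+ b
  a*1+b*1≡a+b = cong₂ ℤ._+_ (ℤ.*-identityʳ (ℤ.+ a)) (ℤ.*-identityʳ (ℤ.+ b))

ℕ→ℚ-mono-≤ : ∀ {a b} → a ℕ.≤ b → ℕ→ℚ a ≤ ℕ→ℚ b
ℕ→ℚ-mono-≤ {a} {b} a≤b rewrite ℕ→ℚ≡mkℚ a | ℕ→ℚ≡mkℚ b =
  *≤* (ℤ.*-monoʳ-≤-nonNeg (ℤ.+ 1) (ℤ.+≤+ a≤b))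

ℕ→ℚ-pos : ∀ {m} → 0 ℕ.< m → Positive (ℕ→ℚ m)
ℕ→ℚ-pos {suc m} _ = ℚ.normalize-pos (suc m) 1

ℕ→ℚ-suc-* : ∀ m a → ℕ→ℚ (suc m) * a ≡ a + ℕ→ℚ m * a
ℕ→ℚ-suc-* m a = begin
  ℕ→ℚ (1 ℕ.+ m) * a          ≡⟨ cong (_* a) (ℕ→ℚ-+ 1 m) ⟩
  (1ℚ + ℕ→ℚ m) * a           ≡⟨ ℚ.*-distribʳ-+ a 1ℚ (ℕ→ℚ m) ⟩
  1ℚ * a + ℕ→ℚ m * a         ≡⟨ cong (_+ ℕ→ℚ m * a) (ℚ.*-identityˡ a) ⟩
  a + ℕ→ℚ m * a ∎
  where open ≡-Reasoning

p≤p+q : ∀ p {q} → 0ℚ ≤ q → p ≤ p + q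
p≤p+q p {q} q≥0 = subst (_≤ p + q) (ℚ.+-identityʳ p) (ℚ.+-monoʳ-≤ p q≥0)

n≤n^suc : ∀ n t → n ℕ.≤ n ℕ.^ suc t
n≤n^suc zero    t = ℕ.z≤n
n≤n^suc (suc n) t = ℕ.m≤m*n (suc n) (suc n ℕ.^ t) {{ℕ.m^n≢0 (suc n) t}}

≤-⌈log₂⌉* : ∀ M {k x} → x ℕ.< k → (M ℕ.≤ 1 → x ≡ 0) → x ℕ.≤ ⌈log₂ M ⌉ ℕ.* k
≤-⌈log₂⌉* M {k} {x} x<k x≡0 with M ℕ.≤? 1
... | yes M≤1 = ℕ.≤-trans (ℕ.≤-reflexive (x≡0 M≤1)) ℕ.z≤n
... | no M≰1  = ℕ.≤-trans (ℕ.<⇒≤ x<k) (ℕ.≤-trans (ℕ.≤-reflexive (sym (ℕ.*-identityˡ k)))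
                  (ℕ.*-monoˡ-≤ k (⌈log₂⌉-mono-≤ {2} {M} (ℕ.≰⇒> M≰1))))

[1-ε]*F≤S : ∀ ε {F S L} → F ≤ S + L → L ≤ ε * F → (1ℚ - ε) * F ≤ S
[1-ε]*F≤S ε {F} {S} {L} F≤S+L L≤εF = begin
  (1ℚ - ε) * F      ≡⟨ ℚ.*-distribʳ-+ F 1ℚ (- ε) ⟩
  1ℚ * F + - ε * F  ≡⟨ cong₂ _+_ (ℚ.*-identityˡ F) (sym (ℚ.neg-distribˡ-* ε F)) ⟩
  F - ε * F         ≤⟨ ℚ.+-monoʳ-≤ F (ℚ.neg-antimono-≤ L≤εF) ⟩
  F - L             ≤⟨ ℚ.+-monoˡ-≤ (- L) F≤S+L ⟩
  S + L - L         ≡⟨ ℚ.+-assoc S L (- L) ⟩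
  S + (L - L)       ≡⟨ cong (S +_) (ℚ.+-inverseʳ L) ⟩
  S + 0ℚ            ≡⟨ ℚ.+-identityʳ S ⟩
  S                 ∎
  where open ℚ.≤-Reasoning

kL≤F⇒L≤εF : ∀ {ε k L F} → 0ℚ ≤ ε → ε * ℕ→ℚ k ≡ 1ℚ → ℕ→ℚ k * L ≤ F → L ≤ ε * F
kL≤F⇒L≤εF {ε} {k} {L} {F} ε≥0 εk≡1 kL≤F = begin
  L                  ≡⟨ ℚ.*-identityˡ L ⟨
  1ℚ * L             ≡⟨ cong (_* L) εk≡1 ⟨
  ε * ℕ→ℚ k * L      ≡⟨ ℚ.*-assoc ε (ℕ→ℚ k) L ⟩
  ε * (ℕ→ℚ k * L)    ≤⟨ ℚ.*-monoˡ-≤-nonNeg ε {{nonNegative ε≥0}} kL≤F ⟩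
  ε * F              ∎
  where open ℚ.≤-Reasoning

module _ {P : ℕ → Set} (P? : Decidable P) where

  -- The least j ∈ [s, s + f] with P j, or s + f if there is none.
  firstFrom : ℕ → ℕ → ℕ
  firstFrom s zero    = s
  firstFrom s (suc f) with P? s
  ... | yes _ = s
  ... | no _  = firstFrom (suc s) f

  firstFrom-sound : ∀ s f → P (s ℕ.+ f) → P (firstFrom s f)
  firstFrom-sound s zero    p = subst P (ℕ.+-identityʳ s) p
  firstFrom-sound s (suc f) p with P? s
  ... | yes ps = ps
  ... | no _   = firstFrom-sound (suc s) f (subst P (ℕ.+-suc s f) p)

  firstFrom-least : ∀ s f {j} → s ℕ.≤ j → P j → firstFrom s f ℕ.≤ j
  firstFrom-least s zero    s≤j _ = s≤j
  firstFrom-least s (suc f) s≤j pj with P? s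
  ... | yes _ = s≤j
  ... | no ¬ps with ℕ.m≤n⇒m<n∨m≡n s≤j
  ...   | inj₁ s<j  = firstFrom-least (suc s) f s<j pj
  ...   | inj₂ refl = contradiction pj ¬ps

module _ {A : Set} where

  ++-∷-split : ∀ (xs : List A) {ys X y Z} → xs ++ ys ≡ X ++ y ∷ Z →
    (∃ λ Z′ → xs ≡ X ++ y ∷ Z′) ⊎ (∃ λ X′ → X ≡ xs ++ X′ × ys ≡ X′ ++ y ∷ Z)
  ++-∷-split []       {X = X}     eq = inj₂ (X , refl , eq)
  ++-∷-split (x ∷ xs) {X = []}    refl = inj₁ (xs , refl)
  ++-∷-split (x ∷ xs) {X = _ ∷ X} eq with refl , eq′ ← ∷-injective eq
    with ++-∷-split xs {X = X} eq′
  ... | inj₁ (Z′ , xs≡) = inj₁ (Z′ , cong (x ∷_) xs≡)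
  ... | inj₂ (X′ , X≡ , ys≡) = inj₂ (X′ , cong (x ∷_) X≡ , ys≡)

  AllPairs-before : ∀ {R : A → A → Set} {X y Z} → AllPairs R (X ++ y ∷ Z) → All (λ x → R x y) X
  AllPairs-before {X = []}    _        = []
  AllPairs-before {X = x ∷ X} (r ∷ rs) = All.head (All.++⁻ʳ X r) ∷ AllPairs-before rs

  All⇒AllPairs : ∀ {P : A → Set} {R : A → A → Set} → (∀ {u v} → P u → P v → R u v) →
    ∀ {xs} → All P xs → AllPairs R xs
  All⇒AllPairs R-PP []         = []
  All⇒AllPairs R-PP (px ∷ pxs) = All.map (R-PP px) pxs ∷ All⇒AllPairs R-PP pxs

  unique-⊆⇒length≤ : DecidableEquality A → ∀ {xs ys : List A} → Unique xs →
    (∀ {x} → x ∈ xs → x ∈ ys) → length xs ℕ.≤ length ys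
  unique-⊆⇒length≤ _≟_ {[]}     _         _    = ℕ.z≤n
  unique-⊆⇒length≤ _≟_ {x ∷ xs} {ys} (x∉xs ∷ u) xs⊆ys = ℕ.≤-trans
    (ℕ.s≤s (unique-⊆⇒length≤ _≟_ u xs⊆ys-x))
    (filter-notAll (λ y → ¬? (x ≟ y)) ys (Any.map (λ x≡y x≢y → x≢y x≡y) (xs⊆ys (here refl))))
    where
    xs⊆ys-x : ∀ {y} → y ∈ xs → y ∈ filter (λ y → ¬? (x ≟ y)) ys
    xs⊆ys-x y∈xs = ∈-filter⁺ (λ y → ¬? (x ≟ y)) (xs⊆ys (there y∈xs)) (λ x≡y → All.lookup x∉xs y∈xs x≡y)

  unique-++ʳ : ∀ xs {ys : List A} → Unique (xs ++ ys) → Unique ys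
  unique-++ʳ []       u       = u
  unique-++ʳ (x ∷ xs) (_ ∷ u) = unique-++ʳ xs u

  unique-++-disjoint : ∀ xs {ys : List A} {y} → Unique (xs ++ ys) → y ∈ ys → ¬ y ∈ xs
  unique-++-disjoint (x ∷ xs) (x∉ ∷ _) y∈ys (here refl) = All.lookup x∉ (∈-++⁺ʳ xs y∈ys) refl
  unique-++-disjoint (x ∷ xs) (_ ∷ u)  y∈ys (there y∈xs) = unique-++-disjoint xs u y∈ys y∈xs

  module _ {P Q R : A → Set} (P? : Decidable P) (Q? : Decidable Q) (R? : Decidable R)
           (P≐Q∪R : P ≐ Q ∪ R) (Q∩R-empty : Empty (Q ∩ R)) where

    filter-↭-⊎ : ∀ xs → filter P? xs ↭ filter Q? xs ++ filter R? xs
    filter-↭-⊎ []       = ↭-refl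
    filter-↭-⊎ (x ∷ xs) with P? x | Q? x | R? x
    ... | _     | yes q | yes r = contradiction (q , r) (Q∩R-empty x)
    ... | yes _ | yes _ | no _  = prep x (filter-↭-⊎ xs)
    ... | yes _ | no _  | yes _ =
      ↭-trans (prep x (filter-↭-⊎ xs)) (↭-sym (shift x (filter Q? xs) (filter R? xs)))
    ... | no _  | no _  | no _  = filter-↭-⊎ xs
    ... | yes p | no ¬q | no ¬r = contradiction (proj₁ P≐Q∪R p) [ ¬q , ¬r ]
    ... | no ¬p | yes q | no _  = contradiction (proj₂ P≐Q∪R (inj₁ q)) ¬p
    ... | no ¬p | no _  | yes r = contradiction (proj₂ P≐Q∪R (inj₂ r)) ¬p

take-++ˡ : ∀ {A : Set} j (xs ys : List A) → j ℕ.≤ length xs → take j (xs ++ ys) ≡ take j xs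
take-++ˡ zero    xs       ys _           = refl
take-++ˡ (suc j) (x ∷ xs) ys (ℕ.s≤s j≤) = cong (x ∷_) (take-++ˡ j xs ys j≤)

unique-take-snoc : ∀ {A : Set} k {xs : List A} {x} → Unique (take k xs) →
  (length xs ℕ.< k → ¬ x ∈ xs) → Unique (take k (xs ++ x ∷ []))
unique-take-snoc k {xs} {x} u fresh with length xs ℕ.<? k
... | no xs≮k  = subst Unique (sym (take-++ˡ k xs (x ∷ []) (ℕ.≮⇒≥ xs≮k))) u
... | yes xs<k = subst Unique (sym (take-all k (xs ++ x ∷ []) (subst (ℕ._≤ k) (sym length-snoc) xs<k)))
  (Unique.++⁺ (subst Unique (take-all k xs (ℕ.<⇒≤ xs<k)) u) ([] ∷ [])
    λ { (x∈ , here refl) → fresh xs<k x∈ })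
  where
  length-snoc : length (xs ++ x ∷ []) ≡ suc (length xs)
  length-snoc = trans (length-++-sucʳ xs x []) (cong (suc ∘ length) (++-identityʳ xs))

∑ : ∀ {A : Set} → (A → ℚ) → List A → ℚ
∑ g []       = 0ℚ
∑ g (x ∷ xs) = g x + ∑ g xs

module _ {A : Set} where

  ∑-++ : ∀ (g : A → ℚ) xs ys → ∑ g (xs ++ ys) ≡ ∑ g xs + ∑ g ys
  ∑-++ g []       ys = sym (ℚ.+-identityˡ (∑ g ys))
  ∑-++ g (x ∷ xs) ys = trans (cong (g x +_) (∑-++ g xs ys)) (sym (ℚ.+-assoc (g x) (∑ g xs) (∑ g ys)))

  ∑-↭ : ∀ (g : A → ℚ) {xs ys} → xs ↭ ys → ∑ g xs ≡ ∑ g ys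
  ∑-↭ g ↭.refl       = refl
  ∑-↭ g (prep x p)   = cong (g x +_) (∑-↭ g p)
  ∑-↭ g (↭.trans p q) = trans (∑-↭ g p) (∑-↭ g q)
  ∑-↭ g (↭.swap {xs} {ys} x y p) = begin
    g x + (g y + ∑ g xs)  ≡⟨ ℚ.+-assoc (g x) (g y) (∑ g xs) ⟨
    (g x + g y) + ∑ g xs  ≡⟨ cong₂ _+_ (ℚ.+-comm (g x) (g y)) (∑-↭ g p) ⟩
    (g y + g x) + ∑ g ys  ≡⟨ ℚ.+-assoc (g y) (g x) (∑ g ys) ⟩
    g y + (g x + ∑ g ys)  ∎
    where open ≡-Reasoning

  ∑-mono : ∀ {g h : A → ℚ} {xs} → All (λ x → g x ≤ h x) xs → ∑ g xs ≤ ∑ h xs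
  ∑-mono []           = ℚ.≤-refl
  ∑-mono (g≤h ∷ g≤hs) = ℚ.+-mono-≤ g≤h (∑-mono g≤hs)

  ∑-nonNeg : ∀ {g : A → ℚ} → (∀ x → 0ℚ ≤ g x) → ∀ xs → 0ℚ ≤ ∑ g xs
  ∑-nonNeg g≥0 []       = ℚ.≤-refl
  ∑-nonNeg g≥0 (x ∷ xs) = ℚ.+-mono-≤ (g≥0 x) (∑-nonNeg g≥0 xs)

  ∑-*ˡ : ∀ a (g : A → ℚ) xs → ∑ (λ x → a * g x) xs ≡ a * ∑ g xs
  ∑-*ˡ a g []       = sym (ℚ.*-zeroʳ a)
  ∑-*ˡ a g (x ∷ xs) = trans (cong (a * g x +_) (∑-*ˡ a g xs)) (sym (ℚ.*-distribˡ-+ a (g x) (∑ g xs)))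

  ∑-const : ∀ a (xs : List A) → ∑ (λ _ → a) xs ≡ ℕ→ℚ (length xs) * a
  ∑-const a []       = sym (ℚ.*-zeroˡ a)
  ∑-const a (x ∷ xs) = trans (cong (a +_) (∑-const a xs)) (sym (ℕ→ℚ-suc-* (length xs) a))

  module _ {P Q R : A → Set} (P? : Decidable P) (Q? : Decidable Q) (R? : Decidable R)
           (P≐Q∪R : P ≐ Q ∪ R) (Q∩R-empty : Empty (Q ∩ R)) where

    ∑-filter-⊎ : ∀ (g : A → ℚ) xs → ∑ g (filter P? xs) ≡ ∑ g (filter Q? xs) + ∑ g (filter R? xs)
    ∑-filter-⊎ g xs = trans (∑-↭ g (filter-↭-⊎ P? Q? R? P≐Q∪R Q∩R-empty xs))
                            (∑-++ g (filter Q? xs) (filter R? xs))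

module _ {A B : Set} (_≟_ : DecidableEquality B) (label : A → B) where
  open import Data.List.Membership.DecPropositional _≟_ using (_∈?_)

  ∑-over-labels : ∀ (g : A → ℚ) xs {ls} → Unique ls →
    ∑ (λ l → ∑ g (filter (λ x → label x ≟ l) xs)) ls ≡ ∑ g (filter (λ x → label x ∈? ls) xs)
  ∑-over-labels g xs {[]}     _           =
    cong (∑ g) (sym (filter-none (λ x → label x ∈? []) (All.universal (λ _ ()) xs)))
  ∑-over-labels g xs {l ∷ ls} (l∉ls ∷ u) = begin
    ∑ g (filter (λ x → label x ≟ l) xs) + ∑ (λ l′ → ∑ g (filter (λ x → label x ≟ l′) xs)) ls
      ≡⟨ cong (∑ g (filter (λ x → label x ≟ l) xs) +_) (∑-over-labels g xs u) ⟩
    ∑ g (filter (λ x → label x ≟ l) xs) + ∑ g (filter (λ x → label x ∈? ls) xs)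
      ≡⟨ ∑-filter-⊎ (λ x → label x ∈? (l ∷ ls)) (λ x → label x ≟ l) (λ x → label x ∈? ls)
           ((λ { (here e) → inj₁ e ; (there m) → inj₂ m }) , [ here , there ])
           (λ { x (refl , m) → All.lookup l∉ls m refl }) g xs ⟨
    ∑ g (filter (λ x → label x ∈? (l ∷ ls)) xs) ∎
    where open ≡-Reasoning

∑-partition : ∀ {A : Set} {k} (label : A → Fin k) (g : A → ℚ) xs →
  ∑ (λ c → ∑ g (filter (λ x → label x Fin.≟ c) xs)) (allFin k) ≡ ∑ g xs
∑-partition {k = k} label g xs = trans
  (∑-over-labels Fin._≟_ label g xs (Unique.allFin⁺ k))
  (cong (∑ g) (filter-all _ (All.universal (λ x → ∈-allFin (label x)) xs)))

argmin-average : ∀ {A : Set} (g : A → ℚ) ⊤ xs → ℕ→ℚ (length xs) * g (argmin g ⊤ xs) ≤ ∑ g xs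
argmin-average g ⊤ xs =
  subst (_≤ ∑ g xs) (∑-const (g (argmin g ⊤ xs)) xs) (∑-mono (f[argmin]≤f[xs] {f = g} ⊤ xs))

-- Sparsifying an order by deleting items

module Sparsify {A : Set} (rank : A → ℕ) {D : A → Set} (D? : Decidable D) where
  open import Data.List.Relation.Binary.Permutation.Setoid.Properties (setoid A) using (Unique-resp-↭)

  Survives : ℕ → A → Set
  Survives τ x = ¬ D x × τ ℕ.≤ rank x

  AtLevel : ℕ → A → Set
  AtLevel a x = ¬ D x × rank x ≡ a

  InBand : ℕ → ℕ → A → Set
  InBand a d x = Survives a x × rank x ℕ.< a ℕ.+ d

  Survives? : ∀ τ → Decidable (Survives τ)
  Survives? τ x = ¬? (D? x) ×-dec (τ ℕ.≤? rank x)

  AtLevel? : ∀ a → Decidable (AtLevel a)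
  AtLevel? a x = ¬? (D? x) ×-dec (rank x ℕ.≟ a)

  InBand? : ∀ a d → Decidable (InBand a d)
  InBand? a d x = Survives? a x ×-dec (rank x ℕ.<? a ℕ.+ d)

  band : ℕ → ℕ → List A → List A
  band a zero    xs = []
  band a (suc d) xs = filter (AtLevel? a) xs ++ band (suc a) d xs

  data Status (τ : ℕ) (x : A) : Set where
    deleted  : D x → τ ℕ.≤ rank x → Status τ x
    survives : Survives τ x → Status τ x
    passed   : rank x ℕ.< τ → Status τ x

  status : ∀ τ x → Status τ x
  status τ x with τ ℕ.≤? rank x | D? x
  ... | no τ≰r  | _      = passed (ℕ.≰⇒> τ≰r)
  ... | yes τ≤r | yes Dx = deleted Dx τ≤r
  ... | yes τ≤r | no ¬Dx = survives (¬Dx , τ≤r)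

  -- A deleted item of rank b ≥ τ frees room for all later survivors of ranks in [τ, b),
  -- which are placed there in order of rank; from then on only ranks ≥ b remain to be placed.
  sparsify : ℕ → List A → List A
  sparsify τ []       = []
  sparsify τ (x ∷ xs) with status τ x
  ... | deleted _ _ = band τ (rank x ℕ.∸ τ) xs ++ sparsify (rank x) xs
  ... | survives _  = x ∷ sparsify τ xs
  ... | passed _    = sparsify τ xs

  band-↭ : ∀ a d xs → band a d xs ↭ filter (InBand? a d) xs
  band-↭ a zero    xs = ↭-reflexive (sym (filter-none (InBand? a 0) (All.universal empty xs)))
    where
    empty : ∀ x → ¬ InBand a 0 x
    empty x ((_ , a≤r) , r<a+0) =
      ℕ.<-irrefl refl (ℕ.<-≤-trans r<a+0 (subst (ℕ._≤ rank x) (sym (ℕ.+-identityʳ a)) a≤r))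
  band-↭ a (suc d) xs = begin
    filter (AtLevel? a) xs ++ band (suc a) d xs
      ↭⟨ ++⁺ˡ (filter (AtLevel? a) xs) (band-↭ (suc a) d xs) ⟩
    filter (AtLevel? a) xs ++ filter (InBand? (suc a) d) xs
      ↭⟨ filter-↭-⊎ (InBand? a (suc d)) (AtLevel? a) (InBand? (suc a) d) (split , join) disjoint xs ⟨
    filter (InBand? a (suc d)) xs
      ∎
    where
    open PermutationReasoning
    split : ∀ {x} → InBand a (suc d) x → AtLevel a x ⊎ InBand (suc a) d x
    split {x} ((¬D , a≤r) , r<) with ℕ.m≤n⇒m<n∨m≡n a≤r
    ... | inj₁ a<r = inj₂ ((¬D , a<r) , subst (rank x ℕ.<_) (ℕ.+-suc a d) r<)
    ... | inj₂ a≡r = inj₁ (¬D , sym a≡r)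
    join : ∀ {x} → AtLevel a x ⊎ InBand (suc a) d x → InBand a (suc d) x
    join (inj₁ (¬D , refl))         = (¬D , ℕ.≤-refl) , ℕ.m<m+n _ ℕ.z<s
    join {x} (inj₂ ((¬D , a<r) , r<)) = (¬D , ℕ.<⇒≤ a<r) , subst (rank x ℕ.<_) (sym (ℕ.+-suc a d)) r<
    disjoint : Empty (AtLevel a ∩ InBand (suc a) d)
    disjoint x ((_ , refl) , (_ , a<a) , _) = ℕ.<-irrefl refl a<a

  Survives-split : ∀ {τ b} → τ ℕ.≤ b → Survives τ ≐ InBand τ (b ℕ.∸ τ) ∪ Survives b
  Survives-split {τ} {b} τ≤b = split , join
    where
    τ+[b∸τ]≡b : τ ℕ.+ (b ℕ.∸ τ) ≡ b
    τ+[b∸τ]≡b = ℕ.m+[n∸m]≡n τ≤b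
    split : ∀ {x} → Survives τ x → InBand τ (b ℕ.∸ τ) x ⊎ Survives b x
    split {x} s@(¬D , _) with rank x ℕ.<? b
    ... | yes r<b = inj₁ (s , subst (rank x ℕ.<_) (sym τ+[b∸τ]≡b) r<b)
    ... | no r≮b  = inj₂ (¬D , ℕ.≮⇒≥ r≮b)
    join : ∀ {x} → InBand τ (b ℕ.∸ τ) x ⊎ Survives b x → Survives τ x
    join (inj₁ (s , _))      = s
    join (inj₂ (¬D , b≤r))   = ¬D , ℕ.≤-trans τ≤b b≤r

  sparsify-↭ : ∀ τ xs → sparsify τ xs ↭ filter (Survives? τ) xs
  sparsify-↭ τ []       = ↭-refl
  sparsify-↭ τ (x ∷ xs) with status τ x
  ... | deleted Dx τ≤r = begin
    B ++ sparsify (rank x) xs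
      ↭⟨ ++⁺ˡ B (sparsify-↭ (rank x) xs) ⟩
    B ++ filter (Survives? (rank x)) xs
      ↭⟨ ++⁺ʳ (filter (Survives? (rank x)) xs) (band-↭ τ (rank x ℕ.∸ τ) xs) ⟩
    filter (InBand? τ (rank x ℕ.∸ τ)) xs ++ filter (Survives? (rank x)) xs
      ↭⟨ filter-↭-⊎ (Survives? τ) (InBand? τ (rank x ℕ.∸ τ)) (Survives? (rank x))
                    (Survives-split τ≤r) disjoint xs ⟨
    filter (Survives? τ) xs
      ≡⟨ filter-reject (Survives? τ) (λ s → proj₁ s Dx) ⟨
    filter (Survives? τ) (x ∷ xs)
      ∎
    where
    open PermutationReasoning
    B : List A
    B = band τ (rank x ℕ.∸ τ) xs
    disjoint : Empty (InBand τ (rank x ℕ.∸ τ) ∩ Survives (rank x))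
    disjoint y ((_ , r<) , (_ , b≤r)) =
      ℕ.<-irrefl refl (ℕ.<-≤-trans (subst (rank y ℕ.<_) (ℕ.m+[n∸m]≡n τ≤r) r<) b≤r)
  ... | survives s =
    ↭-trans (prep x (sparsify-↭ τ xs)) (↭-reflexive (sym (filter-accept (Survives? τ) s)))
  ... | passed r<τ =
    ↭-trans (sparsify-↭ τ xs) (↭-reflexive (sym (filter-reject (Survives? τ) (ℕ.<⇒≱ r<τ ∘ proj₂))))

  ∈-band : ∀ a d xs {y} → y ∈ band a d xs → y ∈ xs × InBand a d y
  ∈-band a d xs y∈ = ∈-filter⁻ (InBand? a d) (∈-resp-↭ (band-↭ a d xs) y∈)

  ∈-sparsify : ∀ τ xs {y} → y ∈ sparsify τ xs → y ∈ xs × Survives τ y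
  ∈-sparsify τ xs y∈ = ∈-filter⁻ (Survives? τ) (∈-resp-↭ (sparsify-↭ τ xs) y∈)

  band-unique : ∀ a d {xs} → Unique xs → Unique (band a d xs)
  band-unique a d {xs} u =
    Unique-resp-↭ (↭⇒↭ₛ (↭-sym (band-↭ a d xs))) (Unique.filter⁺ (InBand? a d) u)

  sparsify-unique : ∀ τ {xs} → Unique xs → Unique (sparsify τ xs)
  sparsify-unique τ {xs} u =
    Unique-resp-↭ (↭⇒↭ₛ (↭-sym (sparsify-↭ τ xs))) (Unique.filter⁺ (Survives? τ) u)

  band-sorted : ∀ a d xs → AllPairs (λ u v → rank u ℕ.≤ rank v) (band a d xs)
  band-sorted a zero    xs = []
  band-sorted a (suc d) xs = AllPairs.++⁺
    (All⇒AllPairs (λ (_ , r≡a) (_ , r′≡a) → ℕ.≤-reflexive (trans r≡a (sym r′≡a)))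
                  (All.all-filter (AtLevel? a) xs))
    (band-sorted (suc a) d xs)
    (All.map below (All.all-filter (AtLevel? a) xs))
    where
    below : ∀ {u} → AtLevel a u → All (λ v → rank u ℕ.≤ rank v) (band (suc a) d xs)
    below (_ , r≡a) = All.tabulate λ v∈ →
      subst (ℕ._≤ _) (sym r≡a) (ℕ.<⇒≤ (proj₂ (proj₁ (proj₂ (∈-band (suc a) d xs v∈)))))

-- Crossings

module _ {n M : ℕ} (cl : Fin n → Fin M) where

  countLater-++ : ∀ m X Y → countLater cl m (X ++ Y) ≡ countLater cl m X ℕ.+ countLater cl m Y
  countLater-++ m []      Y = refl
  countLater-++ m (x ∷ X) Y with m Fin.<? cl x
  ... | yes _ = cong suc (countLater-++ m X Y)
  ... | no _  = countLater-++ m X Y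

  countLater-none : ∀ m {X} → All (λ z → ¬ m Fin.< cl z) X → countLater cl m X ≡ 0
  countLater-none m []               = refl
  countLater-none m {x ∷ X} (m≮ ∷ ms) with m Fin.<? cl x
  ... | yes m< = contradiction m< m≮
  ... | no _   = countLater-none m ms

  countLater-reverse : ∀ m X → countLater cl m (reverse X) ≡ countLater cl m X
  countLater-reverse m []      = refl
  countLater-reverse m (x ∷ X) = begin
    countLater cl m (reverse (x ∷ X))
      ≡⟨ cong (countLater cl m) (unfold-reverse x X) ⟩
    countLater cl m (reverse X ++ x ∷ [])
      ≡⟨ countLater-++ m (reverse X) (x ∷ []) ⟩
    countLater cl m (reverse X) ℕ.+ countLater cl m (x ∷ [])
      ≡⟨ cong (ℕ._+ _) (countLater-reverse m X) ⟩
    countLater cl m X ℕ.+ countLater cl m (x ∷ [])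
      ≡⟨ ℕ.+-comm (countLater cl m X) _ ⟩
    countLater cl m (x ∷ []) ℕ.+ countLater cl m X
      ≡⟨ countLater-++ m (x ∷ []) X ⟨
    countLater cl m (x ∷ X)
      ∎
    where open ≡-Reasoning

  crossRev-≤ : ∀ m B L → (∀ Z y Y → L ≡ Z ++ y ∷ Y → cl y ≡ m → countLater cl m Y ℕ.≤ B) →
    crossRev cl m L ℕ.≤ B
  crossRev-≤ m B []      _ = ℕ.z≤n
  crossRev-≤ m B (x ∷ L) h with cl x FinP.≟ m
  ... | yes x∈m = h [] x L refl x∈m
  ... | no _    = crossRev-≤ m B L (λ Z y Y eq → h (x ∷ Z) y Y (cong (x ∷_) eq))

  cross-≤ : ∀ m B σ → (∀ X y Z → σ ≡ X ++ y ∷ Z → cl y ≡ m → countLater cl m X ℕ.≤ B) →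
    cross cl m σ ℕ.≤ B
  cross-≤ m B σ h = crossRev-≤ m B (reverse σ) λ Z y Y eq y∈m →
    subst (ℕ._≤ B) (countLater-reverse m Y) (h (reverse Y) y (reverse Z) (unreverse eq) y∈m)
    where
    unreverse : ∀ {Z y Y} → reverse σ ≡ Z ++ y ∷ Y → σ ≡ reverse Y ++ y ∷ reverse Z
    unreverse {Z} {y} {Y} eq = begin
      σ                                   ≡⟨ reverse-involutive σ ⟨
      reverse (reverse σ)                 ≡⟨ cong reverse eq ⟩
      reverse (Z ++ y ∷ Y)                ≡⟨ reverse-++ Z (y ∷ Y) ⟩
      reverse (y ∷ Y) ++ reverse Z        ≡⟨ cong (_++ reverse Z) (unfold-reverse y Y) ⟩
      (reverse Y ++ y ∷ []) ++ reverse Z  ≡⟨ ++-assoc (reverse Y) (y ∷ []) (reverse Z) ⟩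
      reverse Y ++ y ∷ reverse Z          ∎
      where open ≡-Reasoning

  maxCross-≤ : ∀ σ B → (∀ m → cross cl m σ ℕ.≤ B) → maxCross cl σ ℕ.≤ B
  maxCross-≤ σ B h = go (allFin M)
    where
    go : ∀ ms → foldr ℕ._⊔_ 0 (map (λ m → cross cl m σ) ms) ℕ.≤ B
    go []       = ℕ.z≤n
    go (m ∷ ms) = ℕ.⊔-lub (h m) (go ms)

module SparseCrossing {n M : ℕ} (cl : Fin n → Fin M) {D : Fin n → Set} (D? : Decidable D) where

  rank : Fin n → ℕ
  rank = Fin.toℕ ∘ cl

  open Sparsify rank D?

  leadingSurvivors : Fin M → List (Fin n) → ℕ
  leadingSurvivors m []       = 0
  leadingSurvivors m (x ∷ xs) with m Fin.<? cl x | D? x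
  ... | yes _ | yes _ = 0
  ... | yes _ | no _  = suc (leadingSurvivors m xs)
  ... | no _  | _     = leadingSurvivors m xs

  leadingSurvivors-below : ∀ m {x} xs → ¬ m Fin.< cl x →
    leadingSurvivors m (x ∷ xs) ≡ leadingSurvivors m xs
  leadingSurvivors-below m {x} xs m≮x with m Fin.<? cl x
  ... | yes m<x = contradiction m<x m≮x
  ... | no _    = refl

  leadingSurvivors-top : ∀ m → (∀ x → ¬ m Fin.< cl x) → ∀ xs → leadingSurvivors m xs ≡ 0
  leadingSurvivors-top m none []       = refl
  leadingSurvivors-top m none (x ∷ xs) =
    trans (leadingSurvivors-below m xs (none x)) (leadingSurvivors-top m none xs)

  countLater-∷-survivor : ∀ m {x X} xs → ¬ D x → countLater cl m X ℕ.≤ leadingSurvivors m xs →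
    countLater cl m (x ∷ X) ℕ.≤ leadingSurvivors m (x ∷ xs)
  countLater-∷-survivor m {x} xs ¬Dx X≤ with m Fin.<? cl x | D? x
  ... | yes _ | yes Dx = contradiction Dx ¬Dx
  ... | yes _ | no _   = ℕ.s≤s X≤
  ... | no _  | _      = X≤

  countLater-before-in-band : ∀ m a d xs {X y Z} → band a d xs ≡ X ++ y ∷ Z → cl y ≡ m →
    countLater cl m X ≡ 0
  countLater-before-in-band m a d xs band≡ refl = countLater-none cl m
    (All.map ℕ.≤⇒≯ (AllPairs-before (subst (AllPairs _) band≡ (band-sorted a d xs))))

  countLater-band-below : ∀ m τ b xs → τ ℕ.≤ b → b ℕ.≤ Fin.toℕ m →
    countLater cl m (band τ (b ℕ.∸ τ) xs) ≡ 0
  countLater-band-below m τ b xs τ≤b b≤m = countLater-none cl m (All.tabulate λ z∈ → ℕ.<⇒≯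
    (ℕ.<-≤-trans (subst (_ ℕ.<_) (ℕ.m+[n∸m]≡n τ≤b) (proj₂ (proj₂ (∈-band τ (b ℕ.∸ τ) xs z∈)))) b≤m))

  -- Items above cluster m can precede y (of cluster m) only as survivors met before the first
  -- deleted item above m: y is placed at the latest in that item's band, ahead of every item
  -- above m, and earlier bands only hold clusters below m.
  sparsify-countLater : ∀ m τ xs {X y Z} → sparsify τ xs ≡ X ++ y ∷ Z → cl y ≡ m → τ ℕ.≤ Fin.toℕ m →
    countLater cl m X ℕ.≤ leadingSurvivors m xs
  sparsify-countLater m τ [] {[]}    () _ _
  sparsify-countLater m τ [] {_ ∷ _} () _ _
  sparsify-countLater m τ (x ∷ xs) {X} {y} eq refl τ≤m with status τ x
  ... | deleted _ τ≤x with ++-∷-split (band τ (rank x ℕ.∸ τ) xs) {X = X} eq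
  ...   | inj₁ (_ , band≡) =
    ℕ.≤-trans (ℕ.≤-reflexive (countLater-before-in-band m τ (rank x ℕ.∸ τ) xs band≡ refl)) ℕ.z≤n
  ...   | inj₂ (X′ , refl , rest≡) = begin
    countLater cl m (B ++ X′)                  ≡⟨ countLater-++ cl m B X′ ⟩
    countLater cl m B ℕ.+ countLater cl m X′   ≡⟨ cong (ℕ._+ _) B-below ⟩
    countLater cl m X′                         ≤⟨ sparsify-countLater m (rank x) xs rest≡ refl x≤m ⟩
    leadingSurvivors m xs                      ≡⟨ leadingSurvivors-below m xs (ℕ.≤⇒≯ x≤m) ⟨
    leadingSurvivors m (x ∷ xs)                ∎
    where
    open ℕ.≤-Reasoning
    B : List (Fin n)
    B = band τ (rank x ℕ.∸ τ) xs
    x≤m : rank x ℕ.≤ Fin.toℕ m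
    x≤m = proj₂ (proj₂ (∈-sparsify (rank x) xs (subst (y ∈_) (sym rest≡) (∈-++⁺ʳ X′ (here refl)))))
    B-below : countLater cl m B ≡ 0
    B-below = countLater-band-below m τ (rank x) xs τ≤x x≤m
  sparsify-countLater m τ (x ∷ xs) {[]}    eq refl τ≤m | survives _ = ℕ.z≤n
  sparsify-countLater m τ (x ∷ xs) {_ ∷ X} eq refl τ≤m | survives (¬Dx , _)
    with refl , eq′ ← ∷-injective eq =
    countLater-∷-survivor m xs ¬Dx (sparsify-countLater m τ xs eq′ refl τ≤m)
  sparsify-countLater m τ (x ∷ xs) eq refl τ≤m | passed x<τ =
    subst (_ ℕ.≤_) (sym (leadingSurvivors-below m xs (ℕ.<⇒≯ (ℕ.<-≤-trans x<τ τ≤m))))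
      (sparsify-countLater m τ xs eq refl τ≤m)

  sparsify-cross : ∀ m xs → cross cl m (sparsify 0 xs) ℕ.≤ leadingSurvivors m xs
  sparsify-cross m xs = cross-≤ cl m _ (sparsify 0 xs) λ X y Z eq y∈m →
    sparsify-countLater m 0 xs eq y∈m ℕ.z≤n

-- Balanced colourings

module Colouring {n M : ℕ} (cl : Fin n → Fin M) (k′ : ℕ) where
  open import Data.List.Membership.DecPropositional (FinP._≟_ {suc k′}) using (_∈?_)

  k : ℕ
  k = suc k′

  Coloured : Set
  Coloured = Fin n × Fin k

  Above : ℕ → Coloured → Set
  Above j (x , _) = j ℕ.< Fin.toℕ (cl x)

  Above? : ∀ j → Decidable (Above j)
  Above? j (x , _) = j ℕ.<? Fin.toℕ (cl x)

  coloursAbove : ℕ → List Coloured → List (Fin k)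
  coloursAbove j H = map proj₂ (filter (Above? j) H)

  -- Since there are only k colours, every colour then occurs among the first k items above j
  -- (when there are that many).
  Balanced : List Coloured → Set
  Balanced H = ∀ j → Unique (take k (coloursAbove j H))

  coloursAbove-antitone : ∀ H {j₁ j₂ c} → j₁ ℕ.≤ j₂ → c ∈ coloursAbove j₂ H → c ∈ coloursAbove j₁ H
  coloursAbove-antitone H {j₁} {j₂} j₁≤j₂ c∈ with (p , p∈ , refl) ← ∈-map⁻ proj₂ c∈
    with p∈H , j₂<p ← ∈-filter⁻ (Above? j₂) {xs = H} p∈ =
    ∈-map⁺ proj₂ (∈-filter⁺ (Above? j₁) {xs = H} p∈H (ℕ.≤-<-trans j₁≤j₂ j₂<p))

  coloursAbove-top : ∀ H → coloursAbove M H ≡ []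
  coloursAbove-top H = cong (map proj₂)
    (filter-none (Above? M) (All.universal (λ (x , _) M<x → ℕ.<-asym M<x (FinP.toℕ<n (cl x))) H))

  coloursAbove-∷ : ∀ j p H → Above j p → coloursAbove j (p ∷ H) ≡ proj₂ p ∷ coloursAbove j H
  coloursAbove-∷ j p H above = cong (map proj₂) (filter-accept (Above? j) above)

  coloursAbove-∷-below : ∀ j p H → ¬ Above j p → coloursAbove j (p ∷ H) ≡ coloursAbove j H
  coloursAbove-∷-below j p H below = cong (map proj₂) (filter-reject (Above? j) below)

  coloursAbove-++ : ∀ j H H′ → coloursAbove j (H ++ H′) ≡ coloursAbove j H ++ coloursAbove j H′
  coloursAbove-++ j H H′ =
    trans (cong (map proj₂) (filter-++ (Above? j) H H′)) (map-++ proj₂ (filter (Above? j) H) _)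

  Sparse : List Coloured → ℕ → Set
  Sparse H j = length (coloursAbove j H) ℕ.< k

  sparseLevel : List Coloured → ℕ
  sparseLevel H = firstFrom (λ j → length (coloursAbove j H) ℕ.<? k) 0 M

  sparseLevel-sparse : ∀ H → Sparse H (sparseLevel H)
  sparseLevel-sparse H = firstFrom-sound (λ j → length (coloursAbove j H) ℕ.<? k) 0 M
    (subst (λ cs → length cs ℕ.< k) (sym (coloursAbove-top H)) ℕ.z<s)

  sparseLevel-least : ∀ H {j} → Sparse H j → sparseLevel H ℕ.≤ j
  sparseLevel-least H = firstFrom-least (λ j → length (coloursAbove j H) ℕ.<? k) 0 M ℕ.z≤n

  fewer-than-k-misses-a-colour : ∀ {cs : List (Fin k)} → length cs ℕ.< k → ∃ λ c → ¬ c ∈ cs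
  fewer-than-k-misses-a-colour {cs} cs<k = FinP.¬∀⟶∃¬ k (_∈ cs) (_∈? cs) λ all∈ →
    ℕ.<⇒≱ cs<k (subst (ℕ._≤ length cs) (length-tabulate id)
      (unique-⊆⇒length≤ FinP._≟_ (Unique.allFin⁺ k) (λ {c} _ → all∈ c)))

  -- coloursAbove shrinks as the level grows, so a colour missing at the least sparse level is
  -- missing at every sparse level.
  freeColour : List Coloured → Fin k
  freeColour H =
    proj₁ (fewer-than-k-misses-a-colour {coloursAbove (sparseLevel H) H} (sparseLevel-sparse H))

  freeColour-fresh : ∀ H {j} → Sparse H j → ¬ freeColour H ∈ coloursAbove j H
  freeColour-fresh H sparse c∈ =
    proj₂ (fewer-than-k-misses-a-colour {coloursAbove (sparseLevel H) H} (sparseLevel-sparse H))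
      (coloursAbove-antitone H (sparseLevel-least H sparse) c∈)

  extend : List Coloured → Fin n → List Coloured
  extend H x = H ++ (x , freeColour H) ∷ []

  coloursAbove-extend : ∀ j H x → Above j (x , freeColour H) →
    coloursAbove j (extend H x) ≡ coloursAbove j H ++ freeColour H ∷ []
  coloursAbove-extend j H x above =
    trans (coloursAbove-++ j H _) (cong (coloursAbove j H ++_) (coloursAbove-∷ j _ [] above))

  coloursAbove-extend-below : ∀ j H x → ¬ Above j (x , freeColour H) →
    coloursAbove j (extend H x) ≡ coloursAbove j H
  coloursAbove-extend-below j H x below = begin
    coloursAbove j (H ++ (x , freeColour H) ∷ [])
      ≡⟨ coloursAbove-++ j H _ ⟩
    coloursAbove j H ++ coloursAbove j ((x , freeColour H) ∷ [])
      ≡⟨ cong (coloursAbove j H ++_) (coloursAbove-∷-below j _ [] below) ⟩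
    coloursAbove j H ++ []
      ≡⟨ ++-identityʳ (coloursAbove j H) ⟩
    coloursAbove j H
      ∎
    where open ≡-Reasoning

  extend-balanced : ∀ H x → Balanced H → Balanced (extend H x)
  extend-balanced H x bal j with j ℕ.<? Fin.toℕ (cl x)
  ... | no j≮x  = subst (Unique ∘ take k) (sym (coloursAbove-extend-below j H x j≮x)) (bal j)
  ... | yes j<x = subst (Unique ∘ take k) (sym (coloursAbove-extend j H x j<x))
                    (unique-take-snoc k (bal j) (freeColour-fresh H))

  colourGreedily : List Coloured → List (Fin n) → List Coloured
  colourGreedily H []       = H
  colourGreedily H (x ∷ xs) = colourGreedily (extend H x) xs

  colourGreedily-balanced : ∀ H xs → Balanced H → Balanced (colourGreedily H xs)
  colourGreedily-balanced H []       bal = bal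
  colourGreedily-balanced H (x ∷ xs) bal =
    colourGreedily-balanced (extend H x) xs (extend-balanced H x bal)

  colourGreedily-items : ∀ H xs → map proj₁ (colourGreedily H xs) ≡ map proj₁ H ++ xs
  colourGreedily-items H []       = sym (++-identityʳ (map proj₁ H))
  colourGreedily-items H (x ∷ xs) = begin
    map proj₁ (colourGreedily (extend H x) xs)    ≡⟨ colourGreedily-items (extend H x) xs ⟩
    map proj₁ (H ++ (x , freeColour H) ∷ []) ++ xs ≡⟨ cong (_++ xs) (map-++ proj₁ H _) ⟩
    (map proj₁ H ++ x ∷ []) ++ xs                  ≡⟨ ++-assoc (map proj₁ H) (x ∷ []) xs ⟩
    map proj₁ H ++ x ∷ xs                          ∎
    where open ≡-Reasoning

  -- Items not listed get the junk colour zero.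
  colourOf : List Coloured → Fin n → Fin k
  colourOf []            x = Fin.zero
  colourOf ((y , c) ∷ H) x with y Fin.≟ x
  ... | yes _ = c
  ... | no _  = colourOf H x

  colourOf-∈ : ∀ H → Unique (map proj₁ H) → ∀ {x c} → (x , c) ∈ H → colourOf H x ≡ c
  colourOf-∈ ((y , d) ∷ H) (y∉H ∷ u) {x} p∈ with y Fin.≟ x | p∈
  ... | yes _    | here refl = refl
  ... | yes refl | there p∈H = contradiction refl (All.lookup y∉H (∈-map⁺ proj₁ p∈H))
  ... | no y≢x   | here refl = contradiction refl y≢x
  ... | no _     | there p∈H = colourOf-∈ H u p∈H

  countUntil : Fin k → List (Fin k) → ℕ
  countUntil c []       = 0
  countUntil c (d ∷ ds) with d Fin.≟ c
  ... | yes _ = 0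
  ... | no _  = suc (countUntil c ds)

  unique-avoiding-< : ∀ {c cs} → Unique cs → ¬ c ∈ cs → length cs ℕ.< k
  unique-avoiding-< {c} {cs} u c∉cs = ℕ.≤-<-trans
    (unique-⊆⇒length≤ FinP._≟_ u λ {d} d∈ →
      ∈-filter⁺ (λ d → ¬? (c Fin.≟ d)) (∈-allFin d) (λ { refl → c∉cs d∈ }))
    (subst (length (filter (λ d → ¬? (c Fin.≟ d)) (allFin k)) ℕ.<_) (length-tabulate id)
      (filter-notAll (λ d → ¬? (c Fin.≟ d)) (allFin k) (Any.map (λ c≡d c≢d → c≢d c≡d) (∈-allFin c))))

  take-countUntil : ∀ c j ds → j ℕ.≤ countUntil c ds → ¬ c ∈ take j ds × length (take j ds) ≡ j
  take-countUntil c zero    ds       _  = (λ ()) , refl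
  take-countUntil c (suc j) (d ∷ ds) j≤ with d Fin.≟ c | j≤
  ... | yes _   | ()
  ... | no d≢c  | ℕ.s≤s j≤′ with c∉ , len≡ ← take-countUntil c j ds j≤′ =
    (λ { (here c≡d) → d≢c (sym c≡d) ; (there c∈) → c∉ c∈ }) , cong suc len≡

  countUntil-< : ∀ c ds → Unique (take k ds) → countUntil c ds ℕ.< k
  countUntil-< c ds u with countUntil c ds ℕ.<? k
  ... | yes < = <
  ... | no ≮ with c∉ , len≡k ← take-countUntil c k ds (ℕ.≮⇒≥ ≮) =
    contradiction (subst (ℕ._< k) len≡k (unique-avoiding-< u c∉)) (ℕ.<-irrefl refl)

-- Profits

module _ {n T : ℕ} (I : Instance n T) where
  open Instance I

  -- φ's step function is local to a where-block of its definition; this exposes it.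
  φ-as-foldr : ∀ i c → ∃ λ step → φ I i c ≡ foldr step 0ℚ (allFin T)
  φ-as-foldr i c = _ , refl

  φ-antitone : (∀ i t → 0ℚ ≤ p i t) → ∀ i {c d} → c ≤ d → φ I i d ≤ φ I i c
  φ-antitone p≥0 i {c} {d} c≤d = foldr-mono (allFin T) step-mono
    where
    step : ℚ → Fin T → ℚ → ℚ
    step e = proj₁ (φ-as-foldr i e)

    foldr-mono : ∀ ts → (∀ t {a b} → a ≤ b → step d t a ≤ step c t b) →
      foldr (step d) 0ℚ ts ≤ foldr (step c) 0ℚ ts
    foldr-mono []       _  = ℚ.≤-refl
    foldr-mono (t ∷ ts) st = st t (foldr-mono ts st)

    step-mono : ∀ t {a b} → a ≤ b → step d t a ≤ step c t b
    step-mono t a≤b with d ℚ.≤? W t | c ℚ.≤? W t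
    ... | yes _   | yes _   = ℚ.⊔-monoʳ-≤ (p i t) a≤b
    ... | yes d≤W | no c≰W  = contradiction (ℚ.≤-trans c≤d d≤W) c≰W
    ... | no _    | yes _   = ℚ.⊔-mono-≤ (p≥0 i t) a≤b
    ... | no _    | no _    = ℚ.⊔-monoʳ-≤ 0ℚ a≤b

separated-by-n : ∀ {n M k} (w : Fin n → ℚ) (cl : Fin n → Fin M) → (∀ i → 0ℚ ≤ w i) →
  (∀ i j → cl i Fin.< cl j →
    ℕ→ℚ (n ℕ.^ (1 ℕ.+ (Fin.toℕ (cl j) ℕ.∸ Fin.toℕ (cl i) ℕ.∸ 1) ℕ.* k)) * w i ≤ w j) →
  ∀ x y → Fin.toℕ (cl y) ℕ.< Fin.toℕ (cl x) → ℕ→ℚ n * w y ≤ w x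
separated-by-n {n} {k = k} w cl w≥0 separation x y y<x = ℚ.≤-trans
  (ℚ.*-monoʳ-≤-nonNeg (w y) {{nonNegative (w≥0 y)}} (ℕ→ℚ-mono-≤ (n≤n^suc n gap))) (separation y x y<x)
  where
  gap : ℕ
  gap = (Fin.toℕ (cl x) ℕ.∸ Fin.toℕ (cl y) ℕ.∸ 1) ℕ.* k

module _ {n M : ℕ} (w : Fin n → ℚ) (cl : Fin n → Fin M) (w≥0 : ∀ i → 0ℚ ≤ w i)
  (separated : ∀ x y → Fin.toℕ (cl y) ℕ.< Fin.toℕ (cl x) → ℕ→ℚ n * w y ≤ w x) where

  -- ys has at most n items, each at least n times lighter than x.
  lighter-∑ : ∀ x ys → Unique ys → (∀ {y} → y ∈ ys → Fin.toℕ (cl y) ℕ.< Fin.toℕ (cl x)) → ∑ w ys ≤ w x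
  lighter-∑ x ys u below =
    ℚ.*-cancelˡ-≤-pos (ℕ→ℚ n) {{ℕ→ℚ-pos (ℕ.≤-<-trans ℕ.z≤n (FinP.toℕ<n x))}} (begin
    ℕ→ℚ n * ∑ w ys             ≡⟨ ∑-*ˡ (ℕ→ℚ n) w ys ⟨
    ∑ (λ y → ℕ→ℚ n * w y) ys   ≤⟨ ∑-mono (All.tabulate (λ y∈ → separated x _ (below y∈))) ⟩
    ∑ (λ _ → w x) ys           ≡⟨ ∑-const (w x) ys ⟩
    ℕ→ℚ (length ys) * w x      ≤⟨ ℚ.*-monoʳ-≤-nonNeg (w x) {{nonNegative (w≥0 x)}} (ℕ→ℚ-mono-≤ ys≤n) ⟩
    ℕ→ℚ n * w x                ∎)
    where
    open ℚ.≤-Reasoning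
    ys≤n : length ys ℕ.≤ n
    ys≤n = subst (length ys ℕ.≤_) (length-tabulate id)
      (unique-⊆⇒length≤ FinP._≟_ u (λ {y} _ → ∈-allFin y))

module Profit {n T : ℕ} (I : Instance n T)
  (w≥0 : ∀ i → 0ℚ ≤ Instance.w I i) (p≥0 : ∀ i t → 0ℚ ≤ Instance.p I i t)
  (π* : List (Fin n)) (π*-unique : Unique π*) where
  open Instance I

  weight : List (Fin n) → ℚ
  weight = ∑ w

  completion : List (Fin n) → Fin n → ℚ
  completion []       y = 0ℚ
  completion (x ∷ xs) y with x Fin.≟ y
  ... | yes _ = w x
  ... | no _  = w x + completion xs y

  completion-nonNeg : ∀ xs y → 0ℚ ≤ completion xs y
  completion-nonNeg []       y = ℚ.≤-refl
  completion-nonNeg (x ∷ xs) y with x Fin.≟ y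
  ... | yes _ = w≥0 x
  ... | no _  = ℚ.+-mono-≤ (w≥0 x) (completion-nonNeg xs y)

  completion-∷-≥ : ∀ x xs y → w x ≤ completion (x ∷ xs) y
  completion-∷-≥ x xs y with x Fin.≟ y
  ... | yes _ = ℚ.≤-refl
  ... | no _  = p≤p+q (w x) (completion-nonNeg xs y)

  completion-head : ∀ x xs → completion (x ∷ xs) x ≡ w x
  completion-head x xs with x Fin.≟ x
  ... | yes _  = refl
  ... | no x≢x = contradiction refl x≢x

  completion-++ : ∀ P xs {y} → ¬ y ∈ P → completion (P ++ xs) y ≡ weight P + completion xs y
  completion-++ []      xs {y} _   = sym (ℚ.+-identityˡ (completion xs y))
  completion-++ (x ∷ P) xs {y} y∉ with x Fin.≟ y
  ... | yes refl = contradiction (here refl) y∉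
  ... | no _     =
    trans (cong (w x +_) (completion-++ P xs (y∉ ∘ there))) (sym (ℚ.+-assoc (w x) (weight P) _))

  weight-snoc : ∀ P x → weight (P ++ x ∷ []) ≡ weight P + w x
  weight-snoc P x = trans (∑-++ w P (x ∷ [])) (cong (weight P +_) (ℚ.+-identityʳ (w x)))

  ΨAcc-++ : ∀ c xs ys → ΨAcc I c (xs ++ ys) ≡ ΨAcc I c xs + ΨAcc I (c + weight xs) ys
  ΨAcc-++ c []       ys =
    trans (cong (λ c′ → ΨAcc I c′ ys) (sym (ℚ.+-identityʳ c))) (sym (ℚ.+-identityˡ _))
  ΨAcc-++ c (x ∷ xs) ys = begin
    φ I x (c + w x) + ΨAcc I (c + w x) (xs ++ ys)
      ≡⟨ cong (φ I x (c + w x) +_) (ΨAcc-++ (c + w x) xs ys) ⟩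
    φ I x (c + w x) + (ΨAcc I (c + w x) xs + ΨAcc I (c + w x + weight xs) ys)
      ≡⟨ ℚ.+-assoc (φ I x (c + w x)) _ _ ⟨
    ΨAcc I c (x ∷ xs) + ΨAcc I (c + w x + weight xs) ys
      ≡⟨ cong (λ c′ → ΨAcc I c (x ∷ xs) + ΨAcc I c′ ys) (ℚ.+-assoc c (w x) (weight xs)) ⟩
    ΨAcc I c (x ∷ xs) + ΨAcc I (c + weight (x ∷ xs)) ys ∎
    where open ≡-Reasoning

  profit* : Fin n → ℚ
  profit* y = φ I y (completion π* y)

  completion*-at : ∀ P x xs → π* ≡ P ++ x ∷ xs → completion π* x ≡ weight P + w x
  completion*-at P x xs eq = begin
    completion π* x                   ≡⟨ cong (λ l → completion l x) eq ⟩
    completion (P ++ x ∷ xs) x        ≡⟨ completion-++ P (x ∷ xs) (unique-++-disjoint P π*-unique′ (here refl)) ⟩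
    weight P + completion (x ∷ xs) x  ≡⟨ cong (weight P +_) (completion-head x xs) ⟩
    weight P + w x                    ∎
    where
    open ≡-Reasoning
    π*-unique′ : Unique (P ++ x ∷ xs)
    π*-unique′ = subst Unique eq π*-unique

  completion*-later : ∀ P x xs {y} → π* ≡ P ++ x ∷ xs → y ∈ xs → weight P + w x ≤ completion π* y
  completion*-later P x xs {y} eq y∈xs = begin
    weight P + w x                    ≤⟨ ℚ.+-monoʳ-≤ (weight P) (completion-∷-≥ x xs y) ⟩
    weight P + completion (x ∷ xs) y  ≡⟨ completion-++ P (x ∷ xs) (unique-++-disjoint P π*-unique′ (there y∈xs)) ⟨
    completion (P ++ x ∷ xs) y        ≡⟨ cong (λ l → completion l y) eq ⟨
    completion π* y                   ∎
    where
    open ℚ.≤-Reasoning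
    π*-unique′ : Unique (P ++ x ∷ xs)
    π*-unique′ = subst Unique eq π*-unique

  ΨAcc*-suffix : ∀ P xs → π* ≡ P ++ xs → ΨAcc I (weight P) xs ≡ ∑ profit* xs
  ΨAcc*-suffix P []       _  = refl
  ΨAcc*-suffix P (x ∷ xs) eq = cong₂ _+_
    (cong (φ I x) (sym (completion*-at P x xs eq)))
    (trans (cong (λ c → ΨAcc I c xs) (sym (weight-snoc P x)))
           (ΨAcc*-suffix (P ++ x ∷ []) xs (trans eq (sym (++-assoc P (x ∷ []) xs)))))

  Ψ*≡∑profit* : Ψ I π* ≡ ∑ profit* π*
  Ψ*≡∑profit* = ΨAcc*-suffix [] π* refl

  block-profit : ∀ c xs → (∀ {y} → y ∈ xs → c + weight xs ≤ completion π* y) → ∑ profit* xs ≤ ΨAcc I c xs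
  block-profit c []       _    = ℚ.≤-refl
  block-profit c (y ∷ xs) fits = ℚ.+-mono-≤
    (φ-antitone I p≥0 y (ℚ.≤-trans (ℚ.+-monoʳ-≤ c (p≤p+q (w y) (∑-nonNeg w≥0 xs))) (fits (here refl))))
    (block-profit (c + w y) xs λ z∈ →
      ℚ.≤-trans (ℚ.≤-reflexive (ℚ.+-assoc c (w y) (weight xs))) (fits (there z∈)))

  module _ {M : ℕ} (cl : Fin n → Fin M) {D : Fin n → Set} (D? : Decidable D)
    (lighter : ∀ x ys → Unique ys → (∀ {y} → y ∈ ys → Fin.toℕ (cl y) ℕ.< Fin.toℕ (cl x)) →
      weight ys ≤ w x)
    where
    rank : Fin n → ℕ
    rank = Fin.toℕ ∘ cl

    open Sparsify rank D?

    prefix-snoc : ∀ {P x xs} → π* ≡ P ++ x ∷ xs → π* ≡ (P ++ x ∷ []) ++ xs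
    prefix-snoc {P} {x} {xs} eq = trans eq (sym (++-assoc P (x ∷ []) xs))

    band-weight : ∀ P x xs {τ} → π* ≡ P ++ x ∷ xs → τ ℕ.≤ rank x →
      weight (band τ (rank x ℕ.∸ τ) xs) ≤ w x
    band-weight P x xs {τ} eq τ≤x = lighter x _
      (band-unique τ (rank x ℕ.∸ τ) (unique-++ʳ (P ++ x ∷ []) (subst Unique (prefix-snoc eq) π*-unique)))
      (λ y∈B → subst (_ ℕ.<_) (ℕ.m+[n∸m]≡n τ≤x) (proj₂ (proj₂ (∈-band τ (rank x ℕ.∸ τ) xs y∈B))))

    -- c is the weight the sparse order has used when the suffix xs of π* = P ++ xs is still to be
    -- processed; the invariant c ≤ weight P says that no item finishes later than in π*.
    sparsify-profit : ∀ τ P xs c → π* ≡ P ++ xs → c ≤ weight P →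
      ∑ profit* (sparsify τ xs) ≤ ΨAcc I c (sparsify τ xs)
    sparsify-profit τ P []       c _  _   = ℚ.≤-refl
    sparsify-profit τ P (x ∷ xs) c eq c≤P with status τ x
    ... | deleted _ τ≤x = begin
      ∑ profit* (B ++ S)                      ≡⟨ ∑-++ profit* B S ⟩
      ∑ profit* B + ∑ profit* S               ≤⟨ ℚ.+-mono-≤ (block-profit c B fits) S-profit ⟩
      ΨAcc I c B + ΨAcc I (c + weight B) S    ≡⟨ ΨAcc-++ c B S ⟨
      ΨAcc I c (B ++ S)                       ∎
      where
      open ℚ.≤-Reasoning
      B S : List (Fin n)
      B = band τ (rank x ℕ.∸ τ) xs
      S = sparsify (rank x) xs
      B-fits : c + weight B ≤ weight (P ++ x ∷ [])
      B-fits = subst (c + weight B ≤_) (sym (weight-snoc P x))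
        (ℚ.+-mono-≤ c≤P (band-weight P x xs eq τ≤x))
      S-profit : ∑ profit* S ≤ ΨAcc I (c + weight B) S
      S-profit = sparsify-profit (rank x) (P ++ x ∷ []) xs (c + weight B) (prefix-snoc eq) B-fits
      fits : ∀ {y} → y ∈ B → c + weight B ≤ completion π* y
      fits y∈B = ℚ.≤-trans B-fits (subst (_≤ _) (sym (weight-snoc P x))
        (completion*-later P x xs eq (proj₁ (∈-band τ (rank x ℕ.∸ τ) xs y∈B))))
    ... | survives _ = ℚ.+-mono-≤
      (φ-antitone I p≥0 x (subst (c + w x ≤_) (sym (completion*-at P x xs eq)) (ℚ.+-monoˡ-≤ (w x) c≤P)))
      (sparsify-profit τ (P ++ x ∷ []) xs (c + w x) (prefix-snoc eq)
        (subst (c + w x ≤_) (sym (weight-snoc P x)) (ℚ.+-monoˡ-≤ (w x) c≤P)))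
    ... | passed _ = sparsify-profit τ (P ++ x ∷ []) xs c (prefix-snoc eq)
      (subst (c ≤_) (sym (weight-snoc P x)) (ℚ.≤-trans c≤P (p≤p+q (weight P) (w≥0 x))))

    sparsify-loss : ∑ profit* π* ≤ Ψ I (sparsify 0 π*) + ∑ profit* (filter D? π*)
    sparsify-loss = begin
      ∑ profit* π*
        ≡⟨ cong (∑ profit*) (filter-all U? (All.universal _ π*)) ⟨
      ∑ profit* (filter U? π*)
        ≡⟨ ∑-filter-⊎ U? (Survives? 0) D? (survives-or-deleted , λ _ → tt) disjoint profit* π* ⟩
      ∑ profit* (filter (Survives? 0) π*) + ∑ profit* (filter D? π*)
        ≡⟨ cong (_+ _) (∑-↭ profit* (sparsify-↭ 0 π*)) ⟨
      ∑ profit* (sparsify 0 π*) + ∑ profit* (filter D? π*)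
        ≤⟨ ℚ.+-monoˡ-≤ _ (sparsify-profit 0 [] π* 0ℚ refl ℚ.≤-refl) ⟩
      Ψ I (sparsify 0 π*) + ∑ profit* (filter D? π*)
        ∎
      where
      open ℚ.≤-Reasoning
      survives-or-deleted : ∀ {x} → U x → Survives 0 x ⊎ D x
      survives-or-deleted {x} _ with D? x
      ... | yes Dx = inj₂ Dx
      ... | no ¬Dx = inj₁ (¬Dx , ℕ.z≤n)
      disjoint : Empty (Survives 0 ∩ D)
      disjoint _ ((¬Dx , _) , Dx) = ¬Dx Dx

module ColourClasses {n M : ℕ} (cl : Fin n → Fin M) (k′ : ℕ) (π* : List (Fin n)) (π*-unique : Unique π*)
  where
  open Colouring cl k′ public using (k)
  open Colouring cl k′ hiding (k)

  colouring : List Coloured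
  colouring = colourGreedily [] π*

  colouring-items : map proj₁ colouring ≡ π*
  colouring-items = colourGreedily-items [] π*

  colour : Fin n → Fin k
  colour = colourOf colouring

  colour-∈ : ∀ {x d} → (x , d) ∈ colouring → colour x ≡ d
  colour-∈ = colourOf-∈ colouring (subst Unique (sym colouring-items) π*-unique)

  InClass? : (c : Fin k) → Decidable (λ x → colour x ≡ c)
  InClass? c x = colour x Fin.≟ c

  dropClass : Fin k → List (Fin n)
  dropClass c = Sparsify.sparsify (Fin.toℕ ∘ cl) (InClass? c) 0 π*

  dropClass-unique : ∀ c → Unique (dropClass c)
  dropClass-unique c = Sparsify.sparsify-unique (Fin.toℕ ∘ cl) (InClass? c) 0 π*-unique

  light-class : ∀ (g : Fin n → ℚ) → ∃ λ c → ℕ→ℚ k * ∑ g (filter (InClass? c) π*) ≤ ∑ g π*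
  light-class g = argmin load Fin.zero (allFin k) , subst₂ _≤_
    (cong (λ l → ℕ→ℚ l * load (argmin load Fin.zero (allFin k))) (length-tabulate {n = k} id))
    (∑-partition colour g π*)
    (argmin-average load Fin.zero (allFin k))
    where
    load : Fin k → ℚ
    load c = ∑ g (filter (InClass? c) π*)

  module _ (c : Fin k) where
    open SparseCrossing cl (InClass? c)

    leadingSurvivors-colours : ∀ m Q → (∀ {x d} → (x , d) ∈ Q → colour x ≡ d) →
      leadingSurvivors m (map proj₁ Q) ≡ countUntil c (coloursAbove (Fin.toℕ m) Q)
    leadingSurvivors-colours m []            _      = refl
    leadingSurvivors-colours m ((x , d) ∷ Q) coloured with m Fin.<? cl x
    ... | no m≮x rewrite coloursAbove-∷-below (Fin.toℕ m) (x , d) Q m≮x =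
      leadingSurvivors-colours m Q (coloured ∘ there)
    ... | yes m<x rewrite coloursAbove-∷ (Fin.toℕ m) (x , d) Q m<x
      with colour x Fin.≟ c | d Fin.≟ c
    ...   | yes _   | yes _   = refl
    ...   | no _    | no _    = cong suc (leadingSurvivors-colours m Q (coloured ∘ there))
    ...   | yes x∈c | no d≢c  = contradiction (trans (sym (coloured (here refl))) x∈c) d≢c
    ...   | no x∉c  | yes d≡c = contradiction (trans (coloured (here refl)) d≡c) x∉c

    leadingSurvivors-< : ∀ m → leadingSurvivors m π* ℕ.< k
    leadingSurvivors-< m = subst (ℕ._< k) (sym counted)
      (countUntil-< c _ (colourGreedily-balanced [] π* (λ _ → []) (Fin.toℕ m)))
      where
      counted : leadingSurvivors m π* ≡ countUntil c (coloursAbove (Fin.toℕ m) colouring)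
      counted = trans (cong (leadingSurvivors m) (sym colouring-items))
                      (leadingSurvivors-colours m colouring colour-∈)

    dropClass-cross : ∀ m → cross cl m (dropClass c) ℕ.≤ ⌈log₂ M ⌉ ℕ.* k
    dropClass-cross m = ℕ.≤-trans (sparsify-cross m π*)
      (≤-⌈log₂⌉* M (leadingSurvivors-< m) λ M≤1 →
        leadingSurvivors-top m (λ x → single-cluster M≤1 (cl x)) π*)
      where
      single-cluster : M ℕ.≤ 1 → ∀ j → ¬ m Fin.< j
      single-cluster M≤1 j m<j = ℕ.<-irrefl refl
        (ℕ.<-≤-trans (ℕ.≤-<-trans (ℕ.≤-trans (ℕ.s≤s ℕ.z≤n) m<j) (FinP.toℕ<n j)) M≤1)

lemma17 : (n T M k : ℕ) (I : Instance n T) (cl : Fin n → Fin M) (ε : ℚ)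
  → 0ℚ < ε → ε < 1ℚ → ε * ℕ→ℚ k ≡ 1ℚ
  → (∀ i → 0ℚ < Instance.w I i)
  → (∀ i t → 0ℚ ≤ Instance.p I i t)
  → (∀ t s → t Fin.≤ s → Instance.W I t ≤ Instance.W I s)
  → Surjective _≡_ _≡_ cl
  → (∀ i j → cl i ≡ cl j → Instance.w I j ≤ ℕ→ℚ (n ℕ.^ k) * Instance.w I i)
  → (∀ i j → cl i Fin.< cl j
       → ℕ→ℚ (n ℕ.^ (1 ℕ.+ (Fin.toℕ (cl j) ℕ.∸ Fin.toℕ (cl i) ℕ.∸ 1) ℕ.* k)) * Instance.w I i
           ≤ Instance.w I j)
  → (πstar : List (Fin n)) → Unique πstar → (∀ i → i ∈ πstar)
  → (∀ (σ : List (Fin n)) → Unique σ → (∀ i → i ∈ σ) → Ψ I σ ≤ Ψ I πstar)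
  → Σ (List (Fin n)) λ πsparse → Unique πsparse
      × maxCross cl πsparse ℕ.≤ ⌈log₂ M ⌉ ℕ.* k
      × (1ℚ - ε) * Ψ I πstar ≤ Ψ I πsparse
lemma17 n T M zero I cl ε _ _ εk≡1 _ _ _ _ _ _ _ _ _ _ =
  contradiction (trans (sym (ℚ.*-zeroʳ ε)) εk≡1) λ ()
lemma17 n T M (suc k′) I cl ε ε>0 _ εk≡1 w>0 p≥0 _ _ _ separation π* π*-unique _ _ =
  dropClass c , dropClass-unique c , maxCross-≤ cl (dropClass c) _ (dropClass-cross c) , profit-bound
  where
  open Instance I
  open ColourClasses cl k′ π* π*-unique

  w≥0 : ∀ i → 0ℚ ≤ w i
  w≥0 i = ℚ.<⇒≤ (w>0 i)

  open Profit I w≥0 p≥0 π* π*-unique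

  c : Fin k
  c = proj₁ (light-class profit*)

  profit-bound : (1ℚ - ε) * Ψ I π* ≤ Ψ I (dropClass c)
  profit-bound = subst (λ Ψ* → (1ℚ - ε) * Ψ* ≤ Ψ I (dropClass c)) (sym Ψ*≡∑profit*)
    ([1-ε]*F≤S ε (sparsify-loss cl (InClass? c) (lighter-∑ w cl w≥0 separated))
      (kL≤F⇒L≤εF {k = k} (ℚ.<⇒≤ ε>0) εk≡1 (proj₂ (light-class profit*))))
    where
    separated : ∀ x y → Fin.toℕ (cl y) ℕ.< Fin.toℕ (cl x) → ℕ→ℚ n * w y ≤ w x
    separated = separated-by-n w cl w≥0 separation
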